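{- Let $\alpha$ be a positive root of $\Phi$ and let $P$ be the directed graph of stretching-class notations constructed from $\alpha$ (as described in the context). Then $P$ is finite and has no directed cycles.
   Context: $\Phi$ is the root system of a crystallographic Cartan matrix $A$ for a Coxeter group with diagram $G$ (simple roots $\alpha_i$ indexed by vertices, $s_i(\beta)=\beta-(\alpha_i,\beta)\alpha_i$ with $(\alpha_i,\alpha_j)=A_{ij}$); roots are identified with integer-valued functions on vertices. Elastic data $(x,L_x,R_x)$: a vertex $x$ and partition of its neighbors. $\mathrm{st}_m(G)$ replaces $x$ by a path $x_0-\cdots-x_m$ of unlabeled edges with $x_0$ joined to $L_x$, $x_m$ joined to $R_x$ by the original labeled edges; its Cartan matrix $\mathrm{st}_m(A)$ has entries $A_{yz}$ off the path, $A_{xz}$ at $(x_0,z)$ for $z\in L_x$ and at $(x_m,z)$ for $z\in R_x$, $A_{yx}$ at $(y,x_0)$ for $y\in L_x$ and at $(y,x_m)$ for $y\in R_x$, $2$ at $(x_i,x_i)$, $-1$ at $(x_i,x_{i\pm1})$, $0$ otherwise. $\mathrm{st}_0(G)=G$. Stretching-class notation: a pair consisting of an integer-valued function $b$ on the vertices of some $\mathrm{st}_m(G)$ and a marking (asterisks) of consecutive path vertices $x_p,\dots,x_q$ ($0\le p\le q\le m$) with $b(x_j)\ne b(x_{j+1})$ for $p\le j<q$. Its left endpoint is $x_p$, right endpoint $x_q$, internal vertices $x_{p+1},\dots,x_{q-1}$. Class left neighbors: $L_x$ if $p=0$, else $\{x_{p-1}\}$; class right neighbors: $R_x$ if $q=m$,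 else $\{x_{q+1}\}$. Weighted left sum $S_L=\sum_{y}-\mathrm{st}_m(A)_{x_p y}b(y)$ over class left neighbors $y$; weighted right sum $S_R=\sum_y -\mathrm{st}_m(A)_{x_q y}b(y)$ over class right neighbors. Reflecting at a vertex $z$ replaces $b(z)$ by $\sum_{y\text{ adjacent to }z}-\mathrm{st}_m(A)_{zy}b(y)-b(z)$ and keeps the marking. Operations: (1) reflect at an unmarked vertex where this decreases the value; (2) reflect at an internal vertex where this decreases the value; (3) if $S_L<b(x_p)$, pass to $\mathrm{st}_{m+1}(G)$ by inserting a new marked vertex with value $S_L$ immediately left of $x_p$ (between the class left neighbors and $x_p$), all other values and marks shifted accordingly; symmetrically on the right if $S_R<b(x_q)$; (4) if $q>p$, reflect at $x_p$ when this decreases its value, and if the new value is $\ge b(x_{p+1})$ remove the mark from it; symmetrically at $x_q$ (compared with $b(x_{q-1})$). $P$ is the directed graph whose vertex set is the smallest set of notations containing $\alpha^*$ (the function $\alpha$ on $\mathrm{st}_0(G)=G$ with $x=x_0$ marked) and closed under these operations, with an arrow from each notation to each result of an operation applied to it, where a result is discarded whenever it has a negative value. -}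

module Defs where

open import Data.Nat as ℕ using (ℕ; zero; suc; _≡ᵇ_)
open import Data.Integer as ℤ using (ℤ; 0ℤ; 1ℤ; -_; _-_; _+_; _*_; _≤_; _<_; +_)
open import Data.Fin as Fin using (Fin)
open import Data.Vec as Vec using (Vec; []; _∷_; lookup; tabulate; _[_]≔_)
open import Data.Vec.Relation.Unary.All as VAll using ()
open import Data.List as List using (List; foldr; map; allFin; upTo)
open import Data.Bool using (Bool; true; false; if_then_else_; _∨_; _∧_)
open import Data.Product using (_×_; Σ)
open import Data.Sum using (_⊎_)
open import Relation.Nullary using (¬_; does)
open import Relation.Binary.PropositionalEquality using (_≡_; _≢_)

sumℤ : List ℤ → ℤ
sumℤ = foldr _+_ 0ℤ

-- total lookup / update / insertion on vectors with a natural-number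
-- index (out-of-range behaviour is junk and never used on P)
vget : ∀ {k} → Vec ℤ k → ℕ → ℤ
vget []       _       = 0ℤ
vget (v ∷ vs) zero    = v
vget (v ∷ vs) (suc i) = vget vs i

vset : ∀ {k} → Vec ℤ k → ℕ → ℤ → Vec ℤ k
vset []       _       _ = []
vset (v ∷ vs) zero    a = a ∷ vs
vset (v ∷ vs) (suc i) a = v ∷ vset vs i a

vins : ∀ {k} → Vec ℤ k → ℕ → ℤ → Vec ℤ (suc k)
vins vs       zero    a = a ∷ vs
vins []       (suc i) a = a ∷ []
vins (v ∷ vs) (suc i) a = v ∷ vins vs i a

NonNeg : ∀ {k} → Vec ℤ k → Set
NonNeg = VAll.All (λ v → 0ℤ ≤ v)

record IsCartan {n : ℕ} (A : Fin n → Fin n → ℤ) : Set where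
  field
    diag     : ∀ i → A i i ≡ + 2
    offdiag  : ∀ i j → i ≢ j → A i j ≤ 0ℤ
    zero-sym : ∀ i j → A i j ≡ 0ℤ → A j i ≡ 0ℤ

module Roots {n : ℕ} (A : Fin n → Fin n → ℤ) where

  -- simple root α_i as a coefficient vector
  simple : Fin n → Vec ℤ n
  simple i = tabulate (λ j → if does (i Fin.≟ j) then 1ℤ else 0ℤ)

  pair : Fin n → Vec ℤ n → ℤ
  pair i β = sumℤ (map (λ j → A i j * lookup β j) (allFin n))

  -- s_i(β) = β - (α_i,β) α_i
  sref : Fin n → Vec ℤ n → Vec ℤ n
  sref i β = β [ i ]≔ (lookup β i - pair i β)

  -- Φ = W-orbit of the simple roots
  data IsRoot : Vec ℤ n → Set where
    simpleRoot : ∀ i → IsRoot (simple i)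
    reflRoot   : ∀ i {β} → IsRoot β → IsRoot (sref i β)

  IsPositiveRoot : Vec ℤ n → Set
  IsPositiveRoot β = IsRoot β × NonNeg β

-- Stretching and stretching-class notations.
-- Elastic data: vertex x, and side : Fin n → Bool;  L_x = neighbours y
-- of x with side y = true, R_x = neighbours with side y = false.

module Stretch {n : ℕ} (A : Fin n → Fin n → ℤ) (x : Fin n)
               (side : Fin n → Bool) where

  -- Vertices of st_m(G): inj₁ k for k ≠ x (original vertices), and
  -- inj₂ i for 0 ≤ i ≤ m (the path vertex x_i).
  Vtx : Set
  Vtx = Fin n ⊎ ℕ

  sameV : Vtx → Vtx → Bool
  sameV (_⊎_.inj₁ k) (_⊎_.inj₁ l) = does (k Fin.≟ l)
  sameV (_⊎_.inj₂ i) (_⊎_.inj₂ j) = i ≡ᵇ j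
  sameV _ _ = false

  stA : ℕ → Vtx → Vtx → ℤ
  stA m (_⊎_.inj₁ y) (_⊎_.inj₁ z) = A y z
  stA m (_⊎_.inj₁ y) (_⊎_.inj₂ i) =
    if (side y ∧ (i ≡ᵇ 0)) ∨ (Data.Bool.not (side y) ∧ (i ≡ᵇ m)) then A y x else 0ℤ
    where import Data.Bool
  stA m (_⊎_.inj₂ i) (_⊎_.inj₁ z) =
    if (side z ∧ (i ≡ᵇ 0)) ∨ (Data.Bool.not (side z) ∧ (i ≡ᵇ m)) then A x z else 0ℤ
    where import Data.Bool
  stA m (_⊎_.inj₂ i) (_⊎_.inj₂ j) =
    if i ≡ᵇ j then + 2 else (if (i ≡ᵇ suc j) ∨ (j ≡ᵇ suc i) then - 1ℤ else 0ℤ)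

  -- A notation: m, the values on original vertices (the entry at x is a
  -- dummy, kept equal to 0; x itself is replaced by the path), the values
  -- b(x_0),…,b(x_m) on the path, and the marked interval x_p … x_q.
  record Notation : Set where
    constructor notation
    field
      m    : ℕ
      off  : Vec ℤ n
      path : Vec ℤ (suc m)
      p    : ℕ
      q    : ℕ
  open Notation public

  val : (N : Notation) → Vtx → ℤ
  val N (_⊎_.inj₁ k) = lookup (off N) k
  val N (_⊎_.inj₂ i) = vget (path N) i

  vertices : ℕ → List Vtx
  vertices m =
    List._++_ (List.map _⊎_.inj₁ (List.filter (λ k → Relation.Nullary.¬? (k Fin.≟ x)) (allFin n)))
              (List.map _⊎_.inj₂ (upTo (suc m)))
    where import Relation.Nullary

  reflVal : Notation → Vtx → ℤ
  reflVal N z =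
    sumℤ (List.map (λ y → if sameV z y then 0ℤ else - (stA (m N) z y * val N y))
                   (vertices (m N)))
    - val N z

  -- original vertices other than x on a given side (class neighbours of
  -- an endpoint at the end of the path; non-neighbours contribute 0)
  sideVerts : Bool → List Vtx
  sideVerts s = List.map _⊎_.inj₁
    (List.filter (λ k → Relation.Nullary.¬? (k Fin.≟ x)) (List.filter (λ k → s Data.Bool.Properties.≟ side k) (allFin n)))
    where import Relation.Nullary
          import Data.Bool
          import Data.Bool.Properties

  SL : Notation → ℤ
  SL N with p N
  ... | zero  = sumℤ (List.map (λ y → - (stA (m N) (_⊎_.inj₂ 0) y * val N y)) (sideVerts true))
  ... | suc j = - (stA (m N) (_⊎_.inj₂ (suc j)) (_⊎_.inj₂ j) * val N (_⊎_.inj₂ j))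

  SR : Notation → ℤ
  SR N with q N ℕ.≟ m N
  ... | Relation.Nullary.yes _ = sumℤ (List.map (λ y → - (stA (m N) (_⊎_.inj₂ (q N)) y * val N y)) (sideVerts false))
  ... | Relation.Nullary.no  _ = - (stA (m N) (_⊎_.inj₂ (q N)) (_⊎_.inj₂ (suc (q N))) * val N (_⊎_.inj₂ (suc (q N))))

  data Op (N : Notation) : Notation → Set where
    op1-orig : ∀ k → k ≢ x → reflVal N (_⊎_.inj₁ k) < lookup (off N) k →
      Op N (notation (m N) (off N [ k ]≔ reflVal N (_⊎_.inj₁ k)) (path N) (p N) (q N))
    op1-path : ∀ i → i ℕ.≤ m N → (i ℕ.< p N ⊎ q N ℕ.< i) →
      reflVal N (_⊎_.inj₂ i) < vget (path N) i →
      Op N (notation (m N) (off N) (vset (path N) i (reflVal N (_⊎_.inj₂ i))) (p N) (q N))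
    op2 : ∀ i → p N ℕ.< i → i ℕ.< q N →
      reflVal N (_⊎_.inj₂ i) < vget (path N) i →
      Op N (notation (m N) (off N) (vset (path N) i (reflVal N (_⊎_.inj₂ i))) (p N) (q N))
    op3L : SL N < vget (path N) (p N) →
      Op N (notation (suc (m N)) (off N) (vins (path N) (p N) (SL N)) (p N) (suc (q N)))
    op3R : SR N < vget (path N) (q N) →
      Op N (notation (suc (m N)) (off N) (vins (path N) (suc (q N)) (SR N)) (p N) (suc (q N)))
    op4L-keep : p N ℕ.< q N →
      reflVal N (_⊎_.inj₂ (p N)) < vget (path N) (p N) →
      reflVal N (_⊎_.inj₂ (p N)) < vget (path N) (suc (p N)) →
      Op N (notation (m N) (off N) (vset (path N) (p N) (reflVal N (_⊎_.inj₂ (p N)))) (p N) (q N))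
    op4L-unmark : p N ℕ.< q N →
      reflVal N (_⊎_.inj₂ (p N)) < vget (path N) (p N) →
      vget (path N) (suc (p N)) ≤ reflVal N (_⊎_.inj₂ (p N)) →
      Op N (notation (m N) (off N) (vset (path N) (p N) (reflVal N (_⊎_.inj₂ (p N)))) (suc (p N)) (q N))
    op4R-keep : p N ℕ.< q N →
      reflVal N (_⊎_.inj₂ (q N)) < vget (path N) (q N) →
      reflVal N (_⊎_.inj₂ (q N)) < vget (path N) (q N ℕ.∸ 1) →
      Op N (notation (m N) (off N) (vset (path N) (q N) (reflVal N (_⊎_.inj₂ (q N)))) (p N) (q N))
    op4R-unmark : p N ℕ.< q N →
      reflVal N (_⊎_.inj₂ (q N)) < vget (path N) (q N) →
      vget (path N) (q N ℕ.∸ 1) ≤ reflVal N (_⊎_.inj₂ (q N)) →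
      Op N (notation (m N) (off N) (vset (path N) (q N) (reflVal N (_⊎_.inj₂ (q N)))) (p N) (q N ℕ.∸ 1))

  Arrow : Notation → Notation → Set
  Arrow N N' = Op N N' × NonNeg (off N') × NonNeg (path N')

  -- α* : α on st_0(G) = G, with x = x_0 marked
  start : Vec ℤ n → Notation
  start α = notation 0 (α [ x ]≔ 0ℤ) (lookup α x ∷ []) 0 0

  data InP (α : Vec ℤ n) : Notation → Set where
    base : InP α (start α)
    step : ∀ {N N'} → InP α N → Arrow N N' → InP α N'

-- Flank the path values b(x_0), …, b(x_m) by the weighted sums S_L and S_R of the class
-- neighbours.  Reflecting at x_j replaces b(x_j) by (left value + right value − b(x_j)), which
-- swaps the two differences adjacent to x_j.  Count the vertices x_0, …, x_p lying above their
-- left value and the vertices x_q, …, x_m lying above their right value.  Reflections at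
-- unmarked or internal vertices only permute these indicators, endpoint reflections can only
-- clear them, and inserting a vertex (operation (3)) clears one.  A reflection at an original
-- vertex may set two of them but lowers the sum of the off-path values, so
-- m + count + 2 · (sum of off-path values) never increases, which bounds m.  All values stay
-- between 0 and their initial maximum, so only finitely many notations are reachable, and each
-- arrow either lengthens the path or lowers the total value, so there are no cycles.

module Submission where

open import Defs
open import Data.Nat using (ℕ)
open import Data.Integer using (ℤ)
open import Data.Fin using (Fin)
open import Data.Bool using (Bool)
open import Data.Vec using (Vec)
open import Data.List using (List)
open import Data.List.Membership.Propositional using (_∈_)
open import Data.Product using (Σ; _×_; _,_; proj₁; proj₂)
open import Relation.Nullary using (¬_)
open import Relation.Binary.Construct.Closure.Transitive using (TransClosure; [_]; _∷_)

import Algebra.Properties.CommutativeSemigroup as CommutativeSemigroupProperties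
open import Data.Bool using (true; false; if_then_else_)
import Data.Bool.Properties as BoolP
import Data.Fin as Fin
open import Data.Integer as ℤ using (0ℤ; 1ℤ; -_; _-_; _+_; _*_; _≤_; _<_; _>_; +_; +≤+)
import Data.Integer.Properties as ℤP
open import Data.Integer.Tactic.RingSolver using (solve-∀)
open import Data.List using ([]; _∷_; map; filter; applyUpTo; upTo; allFin; _++_; concatMap; cartesianProductWith)
open import Data.List.Membership.Propositional.Properties
  using (∈-map⁺; ∈-upTo⁺; ∈-concat⁺′; ∈-cartesianProductWith⁺)
import Data.List.Properties as ListP
import Data.List.Relation.Unary.All as ListAll
import Data.List.Relation.Unary.All.Properties as ListAllP
open import Data.List.Relation.Unary.Any using (here)
open import Data.Nat as ℕ using (zero; suc; _≡ᵇ_; z≤n; s≤s; _∸_)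
import Data.Nat.Properties as ℕP
open import Data.Product.Relation.Binary.Lex.Strict using (×-Lex; ×-transitive; ×-irreflexive)
open import Data.Sum using (_⊎_; inj₁; inj₂)
open import Data.Vec using ([]; _∷_; lookup; _[_]≔_)
open import Data.Vec.Relation.Unary.All as VAll using ([]; _∷_)
import Data.Vec.Relation.Unary.All.Properties as VAllP
open import Function using (_∘_; _$_; flip)
open import Function.Bundles using (Equivalence)
open import Relation.Nullary using (Dec; yes; no; does; contradiction; ¬?)
open import Relation.Binary.PropositionalEquality

module ℕ+ = CommutativeSemigroupProperties ℕP.+-commutativeSemigroup
module ℤ+ = CommutativeSemigroupProperties ℤP.+-commutativeSemigroup

i≤i+j : ∀ i {j} → 0ℤ ≤ j → i ≤ i + j
i≤i+j i {j} 0≤j = subst (_≤ i + j) (ℤP.+-identityʳ i) (ℤP.+-monoʳ-≤ i 0≤j)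

i≤j+i : ∀ i {j} → 0ℤ ≤ j → i ≤ j + i
i≤j+i i {j} 0≤j = subst (_≤ j + i) (ℤP.+-identityˡ i) (ℤP.+-monoˡ-≤ i 0≤j)

neg[-1*i]≡i : ∀ v → - (- 1ℤ * v) ≡ v
neg[-1*i]≡i v = trans (cong -_ (ℤP.-1*i≡-i v)) (ℤP.neg-involutive v)

exceeds : ℤ → ℤ → ℕ
exceeds a c with c ℤ.<? a
... | yes _ = 1
... | no _  = 0

exceeds-≡1 : ∀ {a c} → c < a → exceeds a c ≡ 1
exceeds-≡1 {a} {c} c<a with c ℤ.<? a
... | yes _   = refl
... | no c≮a = contradiction c<a c≮a

exceeds-≡0 : ∀ {a c} → a ≤ c → exceeds a c ≡ 0
exceeds-≡0 {a} {c} a≤c with c ℤ.<? a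
... | yes c<a = contradiction a≤c (ℤP.<⇒≱ c<a)
... | no _    = refl

exceeds≤1 : ∀ a c → exceeds a c ℕ.≤ 1
exceeds≤1 a c with c ℤ.<? a
... | yes _ = s≤s z≤n
... | no _  = z≤n

exceeds-monoˡ-≤ : ∀ {a a'} c → a ≤ a' → exceeds a c ℕ.≤ exceeds a' c
exceeds-monoˡ-≤ {a} c a≤a' with c ℤ.<? a
... | no _    = z≤n
... | yes c<a = ℕP.≤-reflexive (sym (exceeds-≡1 (ℤP.<-≤-trans c<a a≤a')))

exceeds-via-difference : ∀ a c → exceeds a c ≡ exceeds (a - c) 0ℤ
exceeds-via-difference a c with c ℤ.<? a
... | yes c<a = sym (exceeds-≡1 (subst (_< a - c) (ℤP.+-inverseʳ c) (ℤP.+-monoˡ-< (- c) c<a)))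
... | no c≮a  = sym (exceeds-≡0 (ℤP.i≤j⇒i-j≤0 (ℤP.≮⇒≥ c≮a)))

exceeds-cong-difference : ∀ {a c a' c'} → a - c ≡ a' - c' → exceeds a c ≡ exceeds a' c'
exceeds-cong-difference {a} {c} {a'} {c'} eq = begin
  exceeds a c            ≡⟨ exceeds-via-difference a c ⟩
  exceeds (a - c) 0ℤ     ≡⟨ cong (λ d → exceeds d 0ℤ) eq ⟩
  exceeds (a' - c') 0ℤ   ≡⟨ sym (exceeds-via-difference a' c') ⟩
  exceeds a' c'          ∎
  where open ≡-Reasoning

module _ (l c b : ℤ) where

  reflected-exceeds-left : exceeds (l + c - b) l ≡ exceeds c b
  reflected-exceeds-left = exceeds-cong-difference (eq l c b)
    where eq : ∀ l c b → l + c - b - l ≡ c - b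
          eq = solve-∀

  right-exceeds-reflected : exceeds c (l + c - b) ≡ exceeds b l
  right-exceeds-reflected = exceeds-cong-difference (eq l c b)
    where eq : ∀ l c b → c - (l + c - b) ≡ b - l
          eq = solve-∀

  left-exceeds-reflected : exceeds l (l + c - b) ≡ exceeds b c
  left-exceeds-reflected = exceeds-cong-difference (eq l c b)
    where eq : ∀ l c b → l - (l + c - b) ≡ b - c
          eq = solve-∀

  reflected-exceeds-right : exceeds (l + c - b) c ≡ exceeds l b
  reflected-exceeds-right = exceeds-cong-difference (eq l c b)
    where eq : ∀ l c b → l + c - b - c ≡ l - b
          eq = solve-∀

sumℤ-++ : ∀ xs ys → sumℤ (xs ++ ys) ≡ sumℤ xs + sumℤ ys
sumℤ-++ []       ys = sym (ℤP.+-identityˡ (sumℤ ys))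
sumℤ-++ (a ∷ xs) ys = trans (cong (_+_ a) (sumℤ-++ xs ys)) (sym (ℤP.+-assoc a (sumℤ xs) (sumℤ ys)))

sumℤ-map-+ : ∀ {A : Set} (f g : A → ℤ) xs →
  sumℤ (map (λ a → f a + g a) xs) ≡ sumℤ (map f xs) + sumℤ (map g xs)
sumℤ-map-+ f g []       = refl
sumℤ-map-+ f g (a ∷ xs) = trans (cong (_+_ (f a + g a)) (sumℤ-map-+ f g xs)) (ℤ+.interchange (f a) (g a) _ _)

sumℤ-map-cong : ∀ {A : Set} {f g : A → ℤ} → (∀ a → f a ≡ g a) → ∀ xs → sumℤ (map f xs) ≡ sumℤ (map g xs)
sumℤ-map-cong f≗g xs = cong sumℤ (ListP.map-cong f≗g xs)

sumℤ-map-zero : ∀ {A : Set} {f : A → ℤ} → (∀ a → f a ≡ 0ℤ) → ∀ xs → sumℤ (map f xs) ≡ 0ℤ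
sumℤ-map-zero f≗0 []       = refl
sumℤ-map-zero f≗0 (a ∷ xs) = cong₂ _+_ (f≗0 a) (sumℤ-map-zero f≗0 xs)

sumℤ-filter : ∀ {A : Set} {P : A → Set} (P? : ∀ a → Dec (P a)) (f : A → ℤ) xs →
  sumℤ (map f (filter P? xs)) ≡ sumℤ (map (λ a → if does (P? a) then f a else 0ℤ) xs)
sumℤ-filter P? f []       = refl
sumℤ-filter P? f (a ∷ xs) with does (P? a)
... | true  = cong (_+_ (f a)) (sumℤ-filter P? f xs)
... | false = trans (sumℤ-filter P? f xs) (sym (ℤP.+-identityˡ _))

sumℤ-map-if : ∀ {B : Set} c (f : B → ℤ) xs →
  sumℤ (map (λ a → if c then f a else 0ℤ) xs) ≡ (if c then sumℤ (map f xs) else 0ℤ)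
sumℤ-map-if true  f xs = refl
sumℤ-map-if false f xs = sumℤ-map-zero (λ _ → refl) xs

sumℤ-applyUpTo-zero : ∀ {f : ℕ → ℤ} → (∀ j → f j ≡ 0ℤ) → ∀ k → sumℤ (applyUpTo f k) ≡ 0ℤ
sumℤ-applyUpTo-zero f≗0 zero    = refl
sumℤ-applyUpTo-zero f≗0 (suc k) = cong₂ _+_ (f≗0 0) (sumℤ-applyUpTo-zero (λ j → f≗0 (suc j)) k)

sumℤ-upTo-δ : ∀ (g : ℕ → ℤ) {a} k → a ℕ.< k →
  sumℤ (map (λ j → if j ≡ᵇ a then g j else 0ℤ) (upTo k)) ≡ g a
sumℤ-upTo-δ g {a} k a<k = trans (cong sumℤ (ListP.map-upTo _ k)) (go g k a<k)
  where
    go : ∀ (g : ℕ → ℤ) {a} k → a ℕ.< k → sumℤ (applyUpTo (λ j → if j ≡ᵇ a then g j else 0ℤ) k) ≡ g a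
    go g {zero}  (suc k) _         =
      trans (cong (_+_ (g 0)) (sumℤ-applyUpTo-zero (λ _ → refl) k)) (ℤP.+-identityʳ (g 0))
    go g {suc a} (suc k) (s≤s a<k) = trans (ℤP.+-identityˡ _) (go (λ j → g (suc j)) k a<k)

sumℤ-upTo-δ-out : ∀ (g : ℕ → ℤ) {a} k → k ℕ.≤ a →
  sumℤ (map (λ j → if j ≡ᵇ a then g j else 0ℤ) (upTo k)) ≡ 0ℤ
sumℤ-upTo-δ-out g {a} k k≤a = trans (cong sumℤ (ListP.map-upTo _ k)) (go g k k≤a)
  where
    go : ∀ (g : ℕ → ℤ) {a} k → k ℕ.≤ a → sumℤ (applyUpTo (λ j → if j ≡ᵇ a then g j else 0ℤ) k) ≡ 0ℤ
    go g zero    _         = refl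
    go g (suc k) (s≤s k≤a) = trans (ℤP.+-identityˡ _) (go (λ j → g (suc j)) k k≤a)

vsum : ∀ {k} → Vec ℤ k → ℤ
vsum []       = 0ℤ
vsum (a ∷ as) = a + vsum as

vget-vset-≡ : ∀ {k} (v : Vec ℤ k) {i} a → i ℕ.< k → vget (vset v i a) i ≡ a
vget-vset-≡ (b ∷ v) {zero}  a _         = refl
vget-vset-≡ (b ∷ v) {suc i} a (s≤s i<k) = vget-vset-≡ v a i<k

vget-vset-≢ : ∀ {k} (v : Vec ℤ k) {i j} a → j ≢ i → vget (vset v i a) j ≡ vget v j
vget-vset-≢ []      a j≢i = refl
vget-vset-≢ (b ∷ v) {zero}  {zero}  a j≢i = contradiction refl j≢i
vget-vset-≢ (b ∷ v) {zero}  {suc j} a j≢i = refl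
vget-vset-≢ (b ∷ v) {suc i} {zero}  a j≢i = refl
vget-vset-≢ (b ∷ v) {suc i} {suc j} a j≢i = vget-vset-≢ v a (j≢i ∘ cong suc)

vget-vins-< : ∀ {k} (v : Vec ℤ k) {i j} a → j ℕ.< i → i ℕ.≤ k → vget (vins v i a) j ≡ vget v j
vget-vins-< (b ∷ v) {suc i} {zero}  a _         _         = refl
vget-vins-< (b ∷ v) {suc i} {suc j} a (s≤s j<i) (s≤s i≤k) = vget-vins-< v a j<i i≤k

vget-vins-≡ : ∀ {k} (v : Vec ℤ k) {i} a → i ℕ.≤ k → vget (vins v i a) i ≡ a
vget-vins-≡ v       {zero}  a _         = refl
vget-vins-≡ (b ∷ v) {suc i} a (s≤s i≤k) = vget-vins-≡ v a i≤k

vget-vins-> : ∀ {k} (v : Vec ℤ k) {i j} a → i ℕ.≤ j → i ℕ.≤ k → vget (vins v i a) (suc j) ≡ vget v j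
vget-vins-> v       {zero}          a _         _         = refl
vget-vins-> (b ∷ v) {suc i} {suc j} a (s≤s i≤j) (s≤s i≤k) = vget-vins-> v a i≤j i≤k

vsum-vset-< : ∀ {k} (v : Vec ℤ k) {i a} → i ℕ.< k → a < vget v i → vsum (vset v i a) < vsum v
vsum-vset-< (b ∷ v) {zero}  _         a<b = ℤP.+-monoˡ-< (vsum v) a<b
vsum-vset-< (b ∷ v) {suc i} (s≤s i<k) a<  = ℤP.+-monoʳ-< b (vsum-vset-< v i<k a<)

vsum-[]≔-< : ∀ {k} (v : Vec ℤ k) {i a} → a < lookup v i → vsum (v [ i ]≔ a) < vsum v
vsum-[]≔-< (b ∷ v) {Fin.zero}  a<b = ℤP.+-monoˡ-< (vsum v) a<b
vsum-[]≔-< (b ∷ v) {Fin.suc i} a<  = ℤP.+-monoʳ-< b (vsum-[]≔-< v a<)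

All-vset : ∀ {k} {P : ℤ → Set} (v : Vec ℤ k) i {a} → VAll.All P v → P a → VAll.All P (vset v i a)
All-vset []      i       []         pa = []
All-vset (b ∷ v) zero    (pb ∷ pv) pa = pa ∷ pv
All-vset (b ∷ v) (suc i) (pb ∷ pv) pa = pb ∷ All-vset v i pv pa

All-vins : ∀ {k} {P : ℤ → Set} (v : Vec ℤ k) i {a} → VAll.All P v → P a → VAll.All P (vins v i a)
All-vins v       zero    pv         pa = pa ∷ pv
All-vins []      (suc i) []         pa = pa ∷ []
All-vins (b ∷ v) (suc i) (pb ∷ pv) pa = pb ∷ All-vins v i pv pa

All-[]≔ : ∀ {k} {P : ℤ → Set} (v : Vec ℤ k) i {a} → VAll.All P v → P a → VAll.All P (v [ i ]≔ a)
All-[]≔ (b ∷ v) Fin.zero    (pb ∷ pv) pa = pa ∷ pv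
All-[]≔ (b ∷ v) (Fin.suc i) (pb ∷ pv) pa = pb ∷ All-[]≔ v i pv pa

All-vget : ∀ {k} {P : ℤ → Set} (v : Vec ℤ k) i → VAll.All P v → P 0ℤ → P (vget v i)
All-vget []      i       []         p0 = p0
All-vget (b ∷ v) zero    (pb ∷ pv) p0 = pb
All-vget (b ∷ v) (suc i) (pb ∷ pv) p0 = All-vget v i pv p0

vsum-nonneg : ∀ {k} {v : Vec ℤ k} → NonNeg v → 0ℤ ≤ vsum v
vsum-nonneg []          = ℤP.≤-refl
vsum-nonneg (0≤b ∷ 0≤v) = ℤP.+-mono-≤ 0≤b (vsum-nonneg 0≤v)

All-≤-vsum : ∀ {k} {v : Vec ℤ k} → NonNeg v → VAll.All (_≤ vsum v) v
All-≤-vsum []                       = []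
All-≤-vsum {v = b ∷ v} (0≤b ∷ 0≤v) =
  i≤i+j b (vsum-nonneg 0≤v) ∷ VAll.map (λ a≤ → ℤP.≤-trans a≤ (i≤j+i (vsum v) 0≤b)) (All-≤-vsum 0≤v)

rangeSum : (ℕ → ℕ) → ℕ → ℕ → ℕ
rangeSum f lo zero      = 0
rangeSum f lo (suc len) = f lo ℕ.+ rangeSum f (suc lo) len

OnRange : ℕ → ℕ → (ℕ → Set) → Set
OnRange lo len P = ∀ j → lo ℕ.≤ j → j ℕ.< lo ℕ.+ len → P j

module _ {lo len : ℕ} {P : ℕ → Set} where

  OnRange-head : OnRange lo (suc len) P → P lo
  OnRange-head h = h lo ℕP.≤-refl (ℕP.m<m+n lo (s≤s z≤n))

  OnRange-tail : OnRange lo (suc len) P → OnRange (suc lo) len P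
  OnRange-tail h j lo<j j< = h j (ℕP.<⇒≤ lo<j) (subst (j ℕ.<_) (sym (ℕP.+-suc lo len)) j<)

rangeSum-cong : ∀ {f g} lo len → OnRange lo len (λ j → f j ≡ g j) → rangeSum f lo len ≡ rangeSum g lo len
rangeSum-cong lo zero      _ = refl
rangeSum-cong lo (suc len) h = cong₂ ℕ._+_ (OnRange-head h) (rangeSum-cong (suc lo) len (OnRange-tail h))

rangeSum-mono : ∀ {f g} lo len → OnRange lo len (λ j → f j ℕ.≤ g j) → rangeSum f lo len ℕ.≤ rangeSum g lo len
rangeSum-mono lo zero      _ = z≤n
rangeSum-mono lo (suc len) h = ℕP.+-mono-≤ (OnRange-head h) (rangeSum-mono (suc lo) len (OnRange-tail h))

rangeSum-mono-< : ∀ {f g} lo len {i} → OnRange lo len (λ j → f j ℕ.≤ g j) →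
  lo ℕ.≤ i → i ℕ.< lo ℕ.+ len → f i ℕ.< g i → rangeSum f lo len ℕ.< rangeSum g lo len
rangeSum-mono-< lo zero {i} h lo≤i i<lo+0 _ =
  contradiction (ℕP.≤-<-trans lo≤i (subst (i ℕ.<_) (ℕP.+-identityʳ lo) i<lo+0)) (ℕP.<-irrefl refl)
rangeSum-mono-< lo (suc len) {i} h lo≤i i< fi<gi with lo ℕ.≟ i
... | yes refl = ℕP.+-mono-<-≤ fi<gi (rangeSum-mono (suc lo) len (OnRange-tail h))
... | no lo≢i  = ℕP.+-mono-≤-< (OnRange-head h)
  (rangeSum-mono-< (suc lo) len (OnRange-tail h) (ℕP.≤∧≢⇒< lo≤i lo≢i) (subst (i ℕ.<_) (ℕP.+-suc lo len) i<) fi<gi)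

rangeSum-bump : ∀ {f g} lo len i → OnRange lo len (λ j → j ≢ i → f j ℕ.≤ g j) → f i ℕ.≤ 1 →
  rangeSum f lo len ℕ.≤ suc (rangeSum g lo len)
rangeSum-bump lo zero      i _ _     = z≤n
rangeSum-bump {f} {g} lo (suc len) i h fi≤1 with lo ℕ.≟ i
... | yes refl = ℕP.+-mono-≤ (ℕP.≤-trans fi≤1 (s≤s z≤n))
  (rangeSum-mono (suc lo) len (λ j lo<j j< → OnRange-tail h j lo<j j< (ℕP.<⇒≢ lo<j ∘ sym)))
... | no lo≢i  = ℕP.≤-trans
  (ℕP.+-mono-≤ (OnRange-head h lo≢i) (rangeSum-bump (suc lo) len i (OnRange-tail h) fi≤1))
  (ℕP.≤-reflexive (ℕP.+-suc (g lo) _))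

rangeSum-shift : ∀ {f g} lo len → OnRange lo len (λ j → f (suc j) ℕ.≤ g j) →
  rangeSum f (suc lo) len ℕ.≤ rangeSum g lo len
rangeSum-shift lo zero      _ = z≤n
rangeSum-shift lo (suc len) h = ℕP.+-mono-≤ (OnRange-head h) (rangeSum-shift (suc lo) len (OnRange-tail h))

rangeSum-swap : ∀ {f g} lo len {i} → lo ℕ.≤ i → suc i ℕ.< lo ℕ.+ len →
  OnRange lo len (λ j → j ≢ i → j ≢ suc i → f j ≡ g j) → f i ≡ g (suc i) → f (suc i) ≡ g i →
  rangeSum f lo len ≡ rangeSum g lo len
rangeSum-swap lo zero {i} lo≤i si< _ _ _ =
  contradiction (ℕP.≤-<-trans lo≤i (ℕP.<-trans (ℕP.n<1+n i) (subst (suc i ℕ.<_) (ℕP.+-identityʳ lo) si<)))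
                (ℕP.<-irrefl refl)
rangeSum-swap {f} {g} lo (suc len) {i} lo≤i si< h fi gi with lo ℕ.≟ i
rangeSum-swap {f} {g} lo (suc zero)       lo≤i si< h fi gi | yes refl =
  contradiction (subst (suc lo ℕ.<_) (ℕP.+-comm lo 1) si<) (ℕP.<-irrefl refl)
rangeSum-swap {f} {g} lo (suc (suc len)) lo≤i si< h fi gi | yes refl = begin
  f lo ℕ.+ (f (suc lo) ℕ.+ rest f)  ≡⟨ cong₂ (λ a b → a ℕ.+ (b ℕ.+ rest f)) fi gi ⟩
  g (suc lo) ℕ.+ (g lo ℕ.+ rest f)  ≡⟨ cong (λ r → g (suc lo) ℕ.+ (g lo ℕ.+ r)) restEq ⟩
  g (suc lo) ℕ.+ (g lo ℕ.+ rest g)  ≡⟨ ℕ+.x∙yz≈y∙xz (g (suc lo)) (g lo) (rest g) ⟩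
  g lo ℕ.+ (g (suc lo) ℕ.+ rest g)  ∎
  where
    open ≡-Reasoning
    rest : (ℕ → ℕ) → ℕ
    rest k = rangeSum k (suc (suc lo)) len
    restEq : rest f ≡ rest g
    restEq = rangeSum-cong (suc (suc lo)) len λ j lo<j j< →
      OnRange-tail (OnRange-tail h) j lo<j j< (ℕP.<⇒≢ (ℕP.<-trans (ℕP.n<1+n lo) lo<j) ∘ sym) (ℕP.<⇒≢ lo<j ∘ sym)
... | no lo≢i = cong₂ ℕ._+_
  (OnRange-head h lo≢i (ℕP.<⇒≢ (ℕP.≤-<-trans lo≤i (ℕP.n<1+n i))))
  (rangeSum-swap (suc lo) len (ℕP.≤∧≢⇒< lo≤i lo≢i) (subst (suc i ℕ.<_) (ℕP.+-suc lo len) si<)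
                 (OnRange-tail h) fi gi)

rangeSum-snoc : ∀ f lo len → rangeSum f lo (suc len) ≡ rangeSum f lo len ℕ.+ f (lo ℕ.+ len)
rangeSum-snoc f lo zero      = trans (ℕP.+-comm (f lo) 0) (cong f (sym (ℕP.+-identityʳ lo)))
rangeSum-snoc f lo (suc len) = begin
  f lo ℕ.+ rangeSum f (suc lo) (suc len)
    ≡⟨ cong (f lo ℕ.+_) (rangeSum-snoc f (suc lo) len) ⟩
  f lo ℕ.+ (rangeSum f (suc lo) len ℕ.+ f (suc lo ℕ.+ len))
    ≡⟨ sym (ℕP.+-assoc (f lo) _ _) ⟩
  rangeSum f lo (suc len) ℕ.+ f (suc lo ℕ.+ len)
    ≡⟨ cong (λ k → rangeSum f lo (suc len) ℕ.+ f k) (sym (ℕP.+-suc lo len)) ⟩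
  rangeSum f lo (suc len) ℕ.+ f (lo ℕ.+ suc len) ∎
  where open ≡-Reasoning

≡ᵇ-refl : ∀ i → (i ≡ᵇ i) ≡ true
≡ᵇ-refl i = Equivalence.to BoolP.T-≡ (ℕP.≡⇒≡ᵇ i i refl)

≡ᵇ-true⇒≡ : ∀ i j → (i ≡ᵇ j) ≡ true → i ≡ j
≡ᵇ-true⇒≡ i j e = ℕP.≡ᵇ⇒≡ i j (Equivalence.from BoolP.T-≡ e)

≢⇒≡ᵇ-false : ∀ {i j} → i ≢ j → (i ≡ᵇ j) ≡ false
≢⇒≡ᵇ-false {i} {j} i≢j with i ≡ᵇ j in e
... | true  = contradiction (≡ᵇ-true⇒≡ i j e) i≢j
... | false = refl

≡ᵇ-false⇒≢ : ∀ i j → (i ≡ᵇ j) ≡ false → i ≢ j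
≡ᵇ-false⇒≢ i .i e refl with () ← trans (sym (≡ᵇ-refl i)) e

≡ᵇ-comm : ∀ i j → (i ≡ᵇ j) ≡ (j ≡ᵇ i)
≡ᵇ-comm zero    zero    = refl
≡ᵇ-comm zero    (suc j) = refl
≡ᵇ-comm (suc i) zero    = refl
≡ᵇ-comm (suc i) (suc j) = ≡ᵇ-comm i j

module PathValues {n : ℕ} (A : Fin n → Fin n → ℤ) (x : Fin n) (side : Fin n → Bool) where

  open Stretch A x side

  b : Notation → ℕ → ℤ
  b N = vget (path N)

  outerTerm : Notation → Fin n → ℤ
  outerTerm N k = - (A x k * lookup (off N) k)

  nonX : List (Fin n) → List (Fin n)
  nonX = filter (λ k → ¬? (k Fin.≟ x))

  onSide : Bool → List (Fin n) → List (Fin n)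
  onSide s = filter (λ k → s BoolP.≟ side k)

  sideSum : Bool → Notation → ℤ
  sideSum s N = sumℤ (map (outerTerm N) (nonX (onSide s (allFin n))))

  -- the weighted sums S_L and S_R of a class whose left (right) endpoint is x_i
  leftOf : Notation → ℕ → ℤ
  leftOf N zero    = sideSum true N
  leftOf N (suc j) = b N j

  rightOf : Notation → ℕ → ℤ
  rightOf N j = if j ≡ᵇ m N then sideSum false N else b N (suc j)

  private
    sideTerm : Bool → Notation → Fin n → ℤ
    sideTerm s N k = if does (s BoolP.≟ side k) then (if does (¬? (k Fin.≟ x)) then outerTerm N k else 0ℤ) else 0ℤ

    sideSum-total : ∀ s N → sideSum s N ≡ sumℤ (map (sideTerm s N) (allFin n))
    sideSum-total s N = trans (sumℤ-filter _ (outerTerm N) (onSide s (allFin n)))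
                              (sumℤ-filter _ _ (allFin n))

    outerTerm-split : ∀ N i k →
      (if does (¬? (k Fin.≟ x)) then - (stA (m N) (inj₂ i) (inj₁ k) * lookup (off N) k) else 0ℤ)
      ≡ (if i ≡ᵇ 0 then sideTerm true N k else 0ℤ) + (if i ≡ᵇ m N then sideTerm false N k else 0ℤ)
    outerTerm-split N i k with k Fin.≟ x | side k | i ≡ᵇ 0 | i ≡ᵇ m N
    ... | yes _ | true  | true  | true  = refl
    ... | yes _ | true  | true  | false = refl
    ... | yes _ | true  | false | true  = refl
    ... | yes _ | true  | false | false = refl
    ... | yes _ | false | true  | true  = refl
    ... | yes _ | false | true  | false = refl
    ... | yes _ | false | false | true  = refl
    ... | yes _ | false | false | false = refl
    ... | no _  | true  | true  | true  = sym (ℤP.+-identityʳ _)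
    ... | no _  | true  | true  | false = sym (ℤP.+-identityʳ _)
    ... | no _  | true  | false | true  = refl
    ... | no _  | true  | false | false = refl
    ... | no _  | false | true  | true  = sym (ℤP.+-identityˡ _)
    ... | no _  | false | true  | false = refl
    ... | no _  | false | false | true  = sym (ℤP.+-identityˡ _)
    ... | no _  | false | false | false = refl

    outerNeighbours : ∀ N i →
      sumℤ (map (λ k → - (stA (m N) (inj₂ i) (inj₁ k) * lookup (off N) k)) (nonX (allFin n)))
      ≡ (if i ≡ᵇ 0 then sideSum true N else 0ℤ) + (if i ≡ᵇ m N then sideSum false N else 0ℤ)
    outerNeighbours N i =
      trans (sumℤ-filter _ _ (allFin n))
      (trans (sumℤ-map-cong (outerTerm-split N i) (allFin n))
      (trans (sumℤ-map-+ _ _ (allFin n))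
             (cong₂ _+_ (onEnd true (i ≡ᵇ 0)) (onEnd false (i ≡ᵇ m N)))))
      where
        onEnd : ∀ s c → sumℤ (map (λ k → if c then sideTerm s N k else 0ℤ) (allFin n))
                        ≡ (if c then sideSum s N else 0ℤ)
        onEnd s c = trans (sumℤ-map-if c (sideTerm s N) (allFin n))
                          (cong (if c then_else 0ℤ) (sym (sideSum-total s N)))

    pathTerm-split : ∀ N i j →
      (if i ≡ᵇ j then 0ℤ else - (stA (m N) (inj₂ i) (inj₂ j) * b N j))
      ≡ (if i ≡ᵇ suc j then b N j else 0ℤ) + (if j ≡ᵇ suc i then b N j else 0ℤ)
    pathTerm-split N i j with i ≡ᵇ j in e₁ | i ≡ᵇ suc j in e₂ | j ≡ᵇ suc i in e₃
    ... | true  | true  | _     =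
      contradiction (trans (sym (≡ᵇ-true⇒≡ i (suc j) e₂)) (≡ᵇ-true⇒≡ i j e₁)) ℕP.1+n≢n
    ... | true  | false | true  =
      contradiction (trans (sym (≡ᵇ-true⇒≡ j (suc i) e₃)) (sym (≡ᵇ-true⇒≡ i j e₁))) ℕP.1+n≢n
    ... | true  | false | false = refl
    ... | false | true  | true  =
      contradiction (trans (≡ᵇ-true⇒≡ i (suc j) e₂) (cong suc (≡ᵇ-true⇒≡ j (suc i) e₃)))
                    (ℕP.<⇒≢ (ℕP.<-trans (ℕP.n<1+n i) (ℕP.n<1+n (suc i))))
    ... | false | true  | false = trans (neg[-1*i]≡i (b N j)) (sym (ℤP.+-identityʳ (b N j)))
    ... | false | false | true  = trans (neg[-1*i]≡i (b N j)) (sym (ℤP.+-identityˡ (b N j)))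
    ... | false | false | false = refl

    lowerNeighbour : ∀ N i → i ℕ.≤ m N →
      (if i ≡ᵇ 0 then sideSum true N else 0ℤ)
        + sumℤ (map (λ j → if i ≡ᵇ suc j then b N j else 0ℤ) (upTo (suc (m N))))
      ≡ leftOf N i
    lowerNeighbour N zero    _          =
      trans (cong (_+_ (sideSum true N)) (sumℤ-map-zero (λ _ → refl) (upTo (suc (m N)))))
            (ℤP.+-identityʳ (sideSum true N))
    lowerNeighbour N (suc i) 1+i≤m = begin
      0ℤ + sumℤ (map (λ j → if i ≡ᵇ j then b N j else 0ℤ) (upTo (suc (m N))))
        ≡⟨ ℤP.+-identityˡ _ ⟩
      sumℤ (map (λ j → if i ≡ᵇ j then b N j else 0ℤ) (upTo (suc (m N))))
        ≡⟨ sumℤ-map-cong (λ j → cong (if_then b N j else 0ℤ) (≡ᵇ-comm i j)) (upTo (suc (m N))) ⟩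
      sumℤ (map (λ j → if j ≡ᵇ i then b N j else 0ℤ) (upTo (suc (m N))))
        ≡⟨ sumℤ-upTo-δ (b N) (suc (m N)) (ℕP.<-trans (ℕP.n<1+n i) (s≤s 1+i≤m)) ⟩
      b N i ∎
      where open ≡-Reasoning

    upperNeighbour : ∀ N i → i ℕ.≤ m N →
      (if i ≡ᵇ m N then sideSum false N else 0ℤ)
        + sumℤ (map (λ j → if j ≡ᵇ suc i then b N j else 0ℤ) (upTo (suc (m N))))
      ≡ rightOf N i
    upperNeighbour N i i≤m with i ≡ᵇ m N in e
    ... | true  = trans (cong (_+_ (sideSum false N)) 
                          (sumℤ-upTo-δ-out (b N) (suc (m N)) (s≤s (ℕP.≤-reflexive (sym (≡ᵇ-true⇒≡ i (m N) e))))))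
                        (ℤP.+-identityʳ (sideSum false N))
    ... | false = trans (ℤP.+-identityˡ _) 
                    (sumℤ-upTo-δ (b N) (suc (m N)) (s≤s (ℕP.≤∧≢⇒< i≤m (≡ᵇ-false⇒≢ i (m N) e))))

  reflVal-path : ∀ N i → i ℕ.≤ m N → reflVal N (inj₂ i) ≡ leftOf N i + rightOf N i - b N i
  reflVal-path N i i≤m = cong (_- b N i) (begin
    sumℤ (map term (map inj₁ (nonX (allFin n)) ++ map inj₂ (upTo (suc (m N)))))
      ≡⟨ cong sumℤ (ListP.map-++ term (map inj₁ (nonX (allFin n))) _) ⟩
    sumℤ (map term (map inj₁ (nonX (allFin n))) ++ map term (map inj₂ (upTo (suc (m N)))))
      ≡⟨ sumℤ-++ (map term (map inj₁ (nonX (allFin n)))) _ ⟩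
    sumℤ (map term (map inj₁ (nonX (allFin n)))) + sumℤ (map term (map inj₂ (upTo (suc (m N)))))
      ≡⟨ sym (cong₂ _+_ (cong sumℤ (ListP.map-∘ {g = term} {f = inj₁} (nonX (allFin n))))
                        (cong sumℤ (ListP.map-∘ {g = term} {f = inj₂} (upTo (suc (m N)))))) ⟩
    sumℤ (map (term ∘ inj₁) (nonX (allFin n))) + sumℤ (map (term ∘ inj₂) (upTo (suc (m N))))
      ≡⟨ cong₂ _+_ (outerNeighbours N i)
                   (trans (sumℤ-map-cong (pathTerm-split N i) (upTo (suc (m N))))
                          (sumℤ-map-+ below above (upTo (suc (m N))))) ⟩
    (outerL + outerR) + (lower + upper)
      ≡⟨ ℤ+.interchange outerL outerR lower upper ⟩
    (outerL + lower) + (outerR + upper)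
      ≡⟨ cong₂ _+_ (lowerNeighbour N i i≤m) (upperNeighbour N i i≤m) ⟩
    leftOf N i + rightOf N i ∎)
    where
      open ≡-Reasoning
      term : Vtx → ℤ
      term y = if sameV (inj₂ i) y then 0ℤ else - (stA (m N) (inj₂ i) y * val N y)
      below above : ℕ → ℤ
      below j = if i ≡ᵇ suc j then b N j else 0ℤ
      above j = if j ≡ᵇ suc i then b N j else 0ℤ
      outerL outerR lower upper : ℤ
      outerL = if i ≡ᵇ 0 then sideSum true N else 0ℤ
      outerR = if i ≡ᵇ m N then sideSum false N else 0ℤ
      lower  = sumℤ (map below (upTo (suc (m N))))
      upper  = sumℤ (map above (upTo (suc (m N))))

  private
    sideSum-cong : ∀ s N {f : Fin n → ℤ} → (∀ k → s ≡ side k → f k ≡ outerTerm N k) →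
      sumℤ (map f (nonX (onSide s (allFin n)))) ≡ sideSum s N
    sideSum-cong s N f≗ = cong sumℤ (ListP.map-cong-local
      (ListAll.map (f≗ _) (ListAllP.filter⁺ _ (ListAllP.all-filter _ (allFin n)))))

  SL≡leftOf : ∀ N → SL N ≡ leftOf N (p N)
  SL≡leftOf N@(notation m o pa zero q) =
    trans (cong sumℤ (sym (ListP.map-∘ {f = inj₁} (nonX (onSide true (allFin n))))))
          (sideSum-cong true N leftEnd)
    where
      leftEnd : ∀ k → true ≡ side k → - (stA m (inj₂ 0) (inj₁ k) * lookup o k) ≡ outerTerm N k
      leftEnd k true≡side rewrite sym true≡side = refl
  SL≡leftOf (notation m o pa (suc j) q) rewrite ≢⇒≡ᵇ-false (ℕP.1+n≢n {j}) | ≡ᵇ-refl j = neg[-1*i]≡i (vget pa j)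

  SR≡rightOf : ∀ N → q N ℕ.≤ m N → SR N ≡ rightOf N (q N)
  SR≡rightOf N@(notation m o pa p q) q≤m with q ℕ.≟ m
  ... | yes refl rewrite ≡ᵇ-refl q =
    trans (cong sumℤ (sym (ListP.map-∘ {f = inj₁} (nonX (onSide false (allFin n))))))
          (sideSum-cong false N rightEnd)
    where
      rightEnd : ∀ k → false ≡ side k → - (stA q (inj₂ q) (inj₁ k) * lookup o k) ≡ outerTerm N k
      rightEnd k false≡side rewrite sym false≡side | ≡ᵇ-refl q = refl
  ... | no q≢m
    rewrite ≢⇒≡ᵇ-false q≢m | ≢⇒≡ᵇ-false (ℕP.1+n≢n {q} ∘ sym)
          | ≢⇒≡ᵇ-false (ℕP.<⇒≢ (ℕP.<-trans (ℕP.n<1+n q) (ℕP.n<1+n (suc q)))) | ≡ᵇ-refl q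
    = neg[-1*i]≡i (vget pa (suc q))

-- The potential

module Potential {n : ℕ} (A : Fin n → Fin n → ℤ) (x : Fin n) (side : Fin n → Bool) where

  open Stretch A x side
  open PathValues A x side

  aboveLeft aboveRight : Notation → ℕ → ℕ
  aboveLeft  N j = exceeds (b N j) (leftOf N j)
  aboveRight N j = exceeds (b N j) (rightOf N j)

  leftPotential rightPotential potential : Notation → ℕ
  leftPotential  N = rangeSum (aboveLeft N) 0 (suc (p N))
  rightPotential N = rangeSum (aboveRight N) (q N) (suc (m N ∸ q N))
  potential      N = leftPotential N ℕ.+ rightPotential N

  setPath : Notation → ℕ → ℤ → ℕ → ℕ → Notation
  setPath N i r p' q' = notation (m N) (off N) (vset (path N) i r) p' q'

  insertPath : Notation → ℕ → ℤ → ℕ → ℕ → Notation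
  insertPath N i s p' q' = notation (suc (m N)) (off N) (vins (path N) i s) p' q'

  module SetPath (N : Notation) (i : ℕ) (r : ℤ) (p' q' : ℕ) where

    N' : Notation
    N' = setPath N i r p' q'

    b-≢ : ∀ {j} → j ≢ i → b N' j ≡ b N j
    b-≢ = vget-vset-≢ (path N) r

    b-≡ : i ℕ.≤ m N → b N' i ≡ r
    b-≡ i≤m = vget-vset-≡ (path N) r (s≤s i≤m)

    leftOf-≢ : ∀ {j} → j ≢ suc i → leftOf N' j ≡ leftOf N j
    leftOf-≢ {zero}  _      = refl
    leftOf-≢ {suc j} j≢1+i = b-≢ (j≢1+i ∘ cong suc)

    rightOf-≢ : ∀ {j} → suc j ≢ i → rightOf N' j ≡ rightOf N j
    rightOf-≢ {j} 1+j≢i = cong (if j ≡ᵇ m N then sideSum false N else_) (b-≢ 1+j≢i)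

    aboveLeft-≢ : ∀ {j} → j ≢ i → j ≢ suc i → aboveLeft N' j ≡ aboveLeft N j
    aboveLeft-≢ j≢i j≢1+i = cong₂ exceeds (b-≢ j≢i) (leftOf-≢ j≢1+i)

    aboveRight-≢ : ∀ {j} → j ≢ i → suc j ≢ i → aboveRight N' j ≡ aboveRight N j
    aboveRight-≢ j≢i 1+j≢i = cong₂ exceeds (b-≢ j≢i) (rightOf-≢ 1+j≢i)

    leftSum-unchanged : ∀ lo len → lo ℕ.+ len ℕ.≤ i →
      rangeSum (aboveLeft N') lo len ≡ rangeSum (aboveLeft N) lo len
    leftSum-unchanged lo len bound = rangeSum-cong lo len λ j _ j< →
      let j<i = ℕP.<-≤-trans j< bound
      in  aboveLeft-≢ (ℕP.<⇒≢ j<i) (ℕP.<⇒≢ (ℕP.<-trans j<i (ℕP.n<1+n i)))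

    rightSum-unchanged : ∀ lo len → i ℕ.< lo →
      rangeSum (aboveRight N') lo len ≡ rangeSum (aboveRight N) lo len
    rightSum-unchanged lo len i<lo = rangeSum-cong lo len λ j lo≤j _ →
      let i<j = ℕP.<-≤-trans i<lo lo≤j
      in  aboveRight-≢ (ℕP.<⇒≢ i<j ∘ sym) (ℕP.<⇒≢ (ℕP.<-trans i<j (ℕP.n<1+n j)) ∘ sym)

    module _ (r≡ : r ≡ leftOf N i + rightOf N i - b N i) where

      leftSum-reflect : ∀ p₀ → i ℕ.< p₀ → p₀ ℕ.≤ m N →
        rangeSum (aboveLeft N') 0 (suc p₀) ≡ rangeSum (aboveLeft N) 0 (suc p₀)
      leftSum-reflect p₀ i<p₀ p₀≤m =
        rangeSum-swap 0 (suc p₀) z≤n (s≤s i<p₀) (λ j _ _ → aboveLeft-≢) atI atSucI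
        where
          open ≡-Reasoning
          i<m = ℕP.<-≤-trans i<p₀ p₀≤m
          rightOf-i : rightOf N i ≡ b N (suc i)
          rightOf-i = cong (if_then sideSum false N else b N (suc i)) (≢⇒≡ᵇ-false (ℕP.<⇒≢ i<m))
          atI : aboveLeft N' i ≡ aboveLeft N (suc i)
          atI = begin
            exceeds (b N' i) (leftOf N' i)
              ≡⟨ cong₂ exceeds (trans (b-≡ (ℕP.<⇒≤ i<m)) r≡) (leftOf-≢ (ℕP.1+n≢n ∘ sym)) ⟩
            exceeds (leftOf N i + rightOf N i - b N i) (leftOf N i)
              ≡⟨ reflected-exceeds-left (leftOf N i) (rightOf N i) (b N i) ⟩
            exceeds (rightOf N i) (b N i)
              ≡⟨ cong (λ c → exceeds c (b N i)) rightOf-i ⟩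
            exceeds (b N (suc i)) (b N i) ∎
          atSucI : aboveLeft N' (suc i) ≡ aboveLeft N i
          atSucI = begin
            exceeds (b N' (suc i)) (b N' i)
              ≡⟨ cong₂ exceeds (b-≢ ℕP.1+n≢n) (trans (b-≡ (ℕP.<⇒≤ i<m)) r≡) ⟩
            exceeds (b N (suc i)) (leftOf N i + rightOf N i - b N i)
              ≡⟨ cong (λ c → exceeds c (leftOf N i + rightOf N i - b N i)) (sym rightOf-i) ⟩
            exceeds (rightOf N i) (leftOf N i + rightOf N i - b N i)
              ≡⟨ right-exceeds-reflected (leftOf N i) (rightOf N i) (b N i) ⟩
            exceeds (b N i) (leftOf N i) ∎

      rightSum-reflect : ∀ q₀ {i₀} → i ≡ suc i₀ → q₀ ℕ.≤ i₀ → i ℕ.≤ m N →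
        rangeSum (aboveRight N') q₀ (suc (m N ∸ q₀)) ≡ rangeSum (aboveRight N) q₀ (suc (m N ∸ q₀))
      rightSum-reflect q₀ {i₀} refl q₀≤i₀ i≤m =
        rangeSum-swap q₀ (suc (m N ∸ q₀)) q₀≤i₀ i<end
          (λ j _ _ j≢i₀ j≢i → aboveRight-≢ j≢i (j≢i₀ ∘ ℕP.suc-injective)) atI₀ atI
        where
          open ≡-Reasoning
          i<end : i ℕ.< q₀ ℕ.+ suc (m N ∸ q₀)
          i<end = subst (i ℕ.<_) (sym (trans (ℕP.+-suc q₀ _) (cong suc (ℕP.m+[n∸m]≡n q₀≤m)))) (s≤s i≤m)
            where q₀≤m = ℕP.≤-trans (ℕP.<⇒≤ (s≤s q₀≤i₀)) i≤m
          rightOf-i₀ : ∀ M → m M ≡ m N → rightOf M i₀ ≡ b M i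
          rightOf-i₀ M refl = cong (if_then sideSum false M else b M i) (≢⇒≡ᵇ-false (ℕP.<⇒≢ i≤m))
          atI₀ : aboveRight N' i₀ ≡ aboveRight N i
          atI₀ = begin
            exceeds (b N' i₀) (rightOf N' i₀)
              ≡⟨ cong₂ exceeds (b-≢ (ℕP.1+n≢n ∘ sym)) (trans (rightOf-i₀ N' refl) (trans (b-≡ i≤m) r≡)) ⟩
            exceeds (b N i₀) (leftOf N i + rightOf N i - b N i)
              ≡⟨ left-exceeds-reflected (leftOf N i) (rightOf N i) (b N i) ⟩
            exceeds (b N i) (rightOf N i) ∎
          atI : aboveRight N' i ≡ aboveRight N i₀
          atI = begin
            exceeds (b N' i) (rightOf N' i)
              ≡⟨ cong₂ exceeds (trans (b-≡ i≤m) r≡) (rightOf-≢ (ℕP.1+n≢n)) ⟩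
            exceeds (leftOf N i + rightOf N i - b N i) (rightOf N i)
              ≡⟨ reflected-exceeds-right (leftOf N i) (rightOf N i) (b N i) ⟩
            exceeds (b N i₀) (b N i)
              ≡⟨ cong (exceeds (b N i₀)) (sym (rightOf-i₀ N refl)) ⟩
            exceeds (b N i₀) (rightOf N i₀) ∎

    module _ (r<b : r < b N i) (i≤m : i ℕ.≤ m N) where

      leftSum-lower : rangeSum (aboveLeft N') 0 (suc i) ℕ.≤ rangeSum (aboveLeft N) 0 (suc i)
      leftSum-lower = rangeSum-mono 0 (suc i) λ j _ j<1+i → pointwise j (ℕP.≤-pred j<1+i)
        where
          pointwise : ∀ j → j ℕ.≤ i → aboveLeft N' j ℕ.≤ aboveLeft N j
          pointwise j j≤i with j ℕ.≟ i
          ... | yes refl = begin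
            exceeds (b N' i) (leftOf N' i) ≡⟨ cong₂ exceeds (b-≡ i≤m) (leftOf-≢ (ℕP.1+n≢n ∘ sym)) ⟩
            exceeds r (leftOf N i)         ≤⟨ exceeds-monoˡ-≤ (leftOf N i) (ℤP.<⇒≤ r<b) ⟩
            exceeds (b N i) (leftOf N i)   ∎
            where open ℕP.≤-Reasoning
          ... | no j≢i  = ℕP.≤-reflexive (aboveLeft-≢ j≢i (ℕP.<⇒≢ (s≤s j≤i)))

      rightSum-lower : ∀ len → rangeSum (aboveRight N') i len ℕ.≤ rangeSum (aboveRight N) i len
      rightSum-lower len = rangeSum-mono i len λ j i≤j _ → pointwise j i≤j
        where
          pointwise : ∀ j → i ℕ.≤ j → aboveRight N' j ℕ.≤ aboveRight N j
          pointwise j i≤j with j ℕ.≟ i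
          ... | yes refl = begin
            exceeds (b N' i) (rightOf N' i) ≡⟨ cong₂ exceeds (b-≡ i≤m) (rightOf-≢ ℕP.1+n≢n) ⟩
            exceeds r (rightOf N i)         ≤⟨ exceeds-monoˡ-≤ (rightOf N i) (ℤP.<⇒≤ r<b) ⟩
            exceeds (b N i) (rightOf N i)   ∎
            where open ℕP.≤-Reasoning
          ... | no j≢i  = ℕP.≤-reflexive (aboveRight-≢ j≢i (ℕP.<⇒≢ (s≤s i≤j) ∘ sym))

    aboveLeft-unmarked : i ℕ.≤ m N → b N (suc i) ≤ r → aboveLeft N' (suc i) ≡ 0
    aboveLeft-unmarked i≤m b≤r = trans (cong₂ exceeds (b-≢ ℕP.1+n≢n) (b-≡ i≤m)) (exceeds-≡0 b≤r)

    aboveRight-unmarked : ∀ {i₀} → i ≡ suc i₀ → i ℕ.≤ m N → b N i₀ ≤ r → aboveRight N' i₀ ≡ 0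
    aboveRight-unmarked {i₀} refl i≤m b≤r = trans
      (cong₂ exceeds (b-≢ (ℕP.1+n≢n ∘ sym))
                     (trans (cong (if_then sideSum false N else b N' i) (≢⇒≡ᵇ-false (ℕP.<⇒≢ i≤m))) (b-≡ i≤m)))
      (exceeds-≡0 b≤r)

  module InsertPath (N : Notation) (i : ℕ) (s : ℤ) (p' q' : ℕ) (i≤1+m : i ℕ.≤ suc (m N)) where

    N' : Notation
    N' = insertPath N i s p' q'

    b-≡ : b N' i ≡ s
    b-≡ = vget-vins-≡ (path N) s i≤1+m

    leftOf-≤ : ∀ {j} → j ℕ.≤ i → leftOf N' j ≡ leftOf N j
    leftOf-≤ {zero}  _   = refl
    leftOf-≤ {suc j} j<i = vget-vins-< (path N) s j<i i≤1+m

    rightOf-shift : ∀ {j} → i ℕ.≤ suc j → rightOf N' (suc j) ≡ rightOf N j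
    rightOf-shift {j} i≤1+j = cong (if j ≡ᵇ m N then sideSum false N else_) (vget-vins-> (path N) s i≤1+j i≤1+m)

    aboveLeft-< : ∀ {j} → j ℕ.< i → aboveLeft N' j ≡ aboveLeft N j
    aboveLeft-< j<i = cong₂ exceeds (vget-vins-< (path N) s j<i i≤1+m) (leftOf-≤ (ℕP.<⇒≤ j<i))

    aboveRight-shift : ∀ {j} → i ℕ.≤ j → aboveRight N' (suc j) ≡ aboveRight N j
    aboveRight-shift i≤j = cong₂ exceeds (vget-vins-> (path N) s i≤j i≤1+m) (rightOf-shift (ℕP.m≤n⇒m≤1+n i≤j))

  reflectPath : Notation → ℕ → ℕ → ℕ → Notation
  reflectPath N i = setPath N i (reflVal N (inj₂ i))

  potential-reflect-outside : ∀ N {i} → p N ℕ.≤ q N → q N ℕ.≤ m N → i ℕ.≤ m N → i ℕ.< p N ⊎ q N ℕ.< i →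
    potential (reflectPath N i (p N) (q N)) ≡ potential N
  potential-reflect-outside N {i} p≤q q≤m i≤m (inj₁ i<p) = cong₂ ℕ._+_
    (leftSum-reflect (reflVal-path N i i≤m) (p N) i<p (ℕP.≤-trans p≤q q≤m))
    (rightSum-unchanged (q N) (suc (m N ∸ q N)) (ℕP.<-≤-trans i<p p≤q))
    where open SetPath N i (reflVal N (inj₂ i)) (p N) (q N)
  potential-reflect-outside N {suc i₀} p≤q q≤m i≤m (inj₂ q<i) = cong₂ ℕ._+_
    (leftSum-unchanged 0 (suc (p N)) (ℕP.≤-<-trans p≤q q<i))
    (rightSum-reflect (reflVal-path N (suc i₀) i≤m) (q N) refl (ℕP.≤-pred q<i) i≤m)
    where open SetPath N (suc i₀) (reflVal N (inj₂ (suc i₀))) (p N) (q N)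

  potential-reflect-inside : ∀ N {i} → p N ℕ.< i → i ℕ.< q N →
    potential (reflectPath N i (p N) (q N)) ≡ potential N
  potential-reflect-inside N {i} p<i i<q = cong₂ ℕ._+_
    (leftSum-unchanged 0 (suc (p N)) p<i) (rightSum-unchanged (q N) (suc (m N ∸ q N)) i<q)
    where open SetPath N i (reflVal N (inj₂ i)) (p N) (q N)

  potential-lower-left : ∀ N {r} → p N ℕ.< q N → q N ℕ.≤ m N → r < b N (p N) →
    potential (setPath N (p N) r (p N) (q N)) ℕ.≤ potential N
  potential-lower-left N {r} p<q q≤m r<b = ℕP.+-mono-≤
    (leftSum-lower r<b (ℕP.≤-trans (ℕP.<⇒≤ p<q) q≤m))
    (ℕP.≤-reflexive (rightSum-unchanged (q N) (suc (m N ∸ q N)) p<q))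
    where open SetPath N (p N) r (p N) (q N)

  potential-unmark-left : ∀ N {r} → p N ℕ.< q N → q N ℕ.≤ m N → r < b N (p N) → b N (suc (p N)) ≤ r →
    potential (setPath N (p N) r (suc (p N)) (q N)) ℕ.≤ potential N
  potential-unmark-left N {r} p<q q≤m r<b b≤r = ℕP.+-mono-≤ left
    (ℕP.≤-reflexive (rightSum-unchanged (q N) (suc (m N ∸ q N)) p<q))
    where
      open SetPath N (p N) r (suc (p N)) (q N)
      open ℕP.≤-Reasoning
      p≤m = ℕP.≤-trans (ℕP.<⇒≤ p<q) q≤m
      left : leftPotential N' ℕ.≤ leftPotential N
      left = begin
        rangeSum (aboveLeft N') 0 (suc (suc (p N)))
          ≡⟨ rangeSum-snoc (aboveLeft N') 0 (suc (p N)) ⟩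
        rangeSum (aboveLeft N') 0 (suc (p N)) ℕ.+ aboveLeft N' (suc (p N))
          ≡⟨ cong (rangeSum (aboveLeft N') 0 (suc (p N)) ℕ.+_) (aboveLeft-unmarked p≤m b≤r) ⟩
        rangeSum (aboveLeft N') 0 (suc (p N)) ℕ.+ 0
          ≡⟨ ℕP.+-identityʳ _ ⟩
        rangeSum (aboveLeft N') 0 (suc (p N))
          ≤⟨ leftSum-lower r<b p≤m ⟩
        leftPotential N ∎

  potential-lower-right : ∀ N {r} → p N ℕ.< q N → q N ℕ.≤ m N → r < b N (q N) →
    potential (setPath N (q N) r (p N) (q N)) ℕ.≤ potential N
  potential-lower-right N {r} p<q q≤m r<b = ℕP.+-mono-≤
    (ℕP.≤-reflexive (leftSum-unchanged 0 (suc (p N)) p<q))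
    (rightSum-lower r<b q≤m (suc (m N ∸ q N)))
    where open SetPath N (q N) r (p N) (q N)

  potential-unmark-right : ∀ N {r} → p N ℕ.< q N → q N ℕ.≤ m N → r < b N (q N) → b N (q N ∸ 1) ≤ r →
    potential (setPath N (q N) r (p N) (q N ∸ 1)) ℕ.≤ potential N
  potential-unmark-right N@(notation (suc m₀) o pa p (suc q₀)) {r} p<q q≤m r<b b≤r = ℕP.+-mono-≤
    (ℕP.≤-reflexive (leftSum-unchanged 0 (suc p) p<q))
    right
    where
      open SetPath N (suc q₀) r p q₀
      open ℕP.≤-Reasoning
      right : rightPotential N' ℕ.≤ rightPotential N
      right = begin
        rangeSum (aboveRight N') q₀ (suc (suc m₀ ∸ q₀))
          ≡⟨ cong (λ k → rangeSum (aboveRight N') q₀ (suc k)) (ℕP.+-∸-assoc 1 (ℕP.≤-pred q≤m)) ⟩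
        aboveRight N' q₀ ℕ.+ rangeSum (aboveRight N') (suc q₀) (suc (m₀ ∸ q₀))
          ≡⟨ cong (ℕ._+ rangeSum (aboveRight N') (suc q₀) (suc (m₀ ∸ q₀))) (aboveRight-unmarked refl q≤m b≤r) ⟩
        rangeSum (aboveRight N') (suc q₀) (suc (m₀ ∸ q₀))
          ≤⟨ rightSum-lower r<b q≤m (suc (m₀ ∸ q₀)) ⟩
        rightPotential N ∎

  potential-insert-left : ∀ N → p N ℕ.≤ q N → q N ℕ.≤ m N → SL N < b N (p N) →
    suc (potential (insertPath N (p N) (SL N) (p N) (suc (q N)))) ℕ.≤ potential N
  potential-insert-left N p≤q q≤m SL<b = ℕP.+-mono-≤ left right
    where
      open InsertPath N (p N) (SL N) (p N) (suc (q N)) (ℕP.m≤n⇒m≤1+n (ℕP.≤-trans p≤q q≤m))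
      SL≡ = SL≡leftOf N
      new≡0 : aboveLeft N' (p N) ≡ 0
      new≡0 = trans (cong₂ exceeds b-≡ (leftOf-≤ ℕP.≤-refl)) (exceeds-≡0 (ℤP.≤-reflexive SL≡))
      old≡1 : aboveLeft N (p N) ≡ 1
      old≡1 = exceeds-≡1 (subst (_< b N (p N)) SL≡ SL<b)
      pointwise : ∀ j → j ℕ.≤ p N → aboveLeft N' j ℕ.≤ aboveLeft N j
      pointwise j j≤p with j ℕ.≟ p N
      ... | yes refl = subst (ℕ._≤ aboveLeft N (p N)) (sym new≡0) z≤n
      ... | no j≢p   = ℕP.≤-reflexive (aboveLeft-< (ℕP.≤∧≢⇒< j≤p j≢p))
      left : suc (leftPotential N') ℕ.≤ leftPotential N
      left = rangeSum-mono-< 0 (suc (p N)) (λ j _ j<1+p → pointwise j (ℕP.≤-pred j<1+p)) z≤n ℕP.≤-refl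
               (subst₂ ℕ._<_ (sym new≡0) (sym old≡1) (s≤s z≤n))
      right : rightPotential N' ℕ.≤ rightPotential N
      right = rangeSum-shift (q N) (suc (m N ∸ q N)) λ j q≤j _ →
                ℕP.≤-reflexive (aboveRight-shift (ℕP.≤-trans p≤q q≤j))

  potential-insert-right : ∀ N → p N ℕ.≤ q N → q N ℕ.≤ m N → SR N < b N (q N) →
    suc (potential (insertPath N (suc (q N)) (SR N) (p N) (suc (q N)))) ℕ.≤ potential N
  potential-insert-right N p≤q q≤m SR<b = begin
    suc (leftPotential N' ℕ.+ rightPotential N') ≡⟨ sym (ℕP.+-suc _ _) ⟩
    leftPotential N' ℕ.+ suc (rightPotential N') ≤⟨ ℕP.+-mono-≤ left right ⟩
    potential N                                  ∎
    where
      open InsertPath N (suc (q N)) (SR N) (p N) (suc (q N)) (s≤s q≤m)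
      open ℕP.≤-Reasoning
      SR≡ = SR≡rightOf N q≤m
      new≡0 : aboveRight N' (suc (q N)) ≡ 0
      new≡0 = trans (cong₂ exceeds b-≡ (rightOf-shift ℕP.≤-refl)) (exceeds-≡0 (ℤP.≤-reflexive SR≡))
      old≡1 : aboveRight N (q N) ≡ 1
      old≡1 = exceeds-≡1 (subst (_< b N (q N)) SR≡ SR<b)
      left : leftPotential N' ℕ.≤ leftPotential N
      left = rangeSum-mono 0 (suc (p N)) λ j _ j<1+p →
               ℕP.≤-reflexive (aboveLeft-< (ℕP.≤-<-trans (ℕP.≤-pred j<1+p) (s≤s p≤q)))
      right : suc (rightPotential N') ℕ.≤ rightPotential N
      right = ℕP.+-mono-≤ (ℕP.≤-reflexive (trans (cong suc new≡0) (sym old≡1)))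
                (rangeSum-shift (suc (q N)) (m N ∸ q N) λ j 1+q≤j _ → ℕP.≤-reflexive (aboveRight-shift 1+q≤j))

  updateOuter : Notation → Fin n → ℤ → Notation
  updateOuter N k r = notation (m N) (off N [ k ]≔ r) (path N) (p N) (q N)

  potential-update-outer : ∀ N k r → potential (updateOuter N k r) ℕ.≤ 2 ℕ.+ potential N
  potential-update-outer N k r = begin
    leftPotential N' ℕ.+ rightPotential N'             ≤⟨ ℕP.+-mono-≤ left right ⟩
    suc (leftPotential N) ℕ.+ suc (rightPotential N) ≡⟨ cong suc (ℕP.+-suc _ _) ⟩
    2 ℕ.+ potential N                                ∎
    where
      open ℕP.≤-Reasoning
      N' = updateOuter N k r
      inner-left : ∀ j → j ≢ 0 → aboveLeft N' j ℕ.≤ aboveLeft N j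
      inner-left zero    0≢0 = contradiction refl 0≢0
      inner-left (suc j) _   = ℕP.≤-refl
      inner-right : ∀ j → j ≢ m N → aboveRight N' j ℕ.≤ aboveRight N j
      inner-right j j≢m rewrite ≢⇒≡ᵇ-false j≢m = ℕP.≤-refl
      left : leftPotential N' ℕ.≤ suc (leftPotential N)
      left = rangeSum-bump 0 (suc (p N)) 0 (λ j _ _ → inner-left j) (exceeds≤1 _ _)
      right : rightPotential N' ℕ.≤ suc (rightPotential N)
      right = rangeSum-bump (q N) (suc (m N ∸ q N)) (m N) (λ j _ _ → inner-right j) (exceeds≤1 _ _)

vectorsOver : ∀ {A : Set} → List A → (k : ℕ) → List (Vec A k)
vectorsOver L zero    = [] ∷ []
vectorsOver L (suc k) = cartesianProductWith _∷_ L (vectorsOver L k)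

∈-vectorsOver : ∀ {A : Set} {L : List A} {k} {v : Vec A k} → VAll.All (_∈ L) v → v ∈ vectorsOver L k
∈-vectorsOver []         = here refl
∈-vectorsOver (a∈ ∷ v∈) = ∈-cartesianProductWith⁺ _∷_ a∈ (∈-vectorsOver v∈)

integersUpTo : ℤ → List ℤ
integersUpTo B = map +_ (upTo (suc ℤ.∣ B ∣))

∈-integersUpTo : ∀ {z B} → 0ℤ ≤ z → z ≤ B → z ∈ integersUpTo B
∈-integersUpTo {+ k} {B} _ k≤B = ∈-map⁺ +_ (∈-upTo⁺ (s≤s k≤∣B∣))
  where
    k≤∣B∣ : k ℕ.≤ ℤ.∣ B ∣
    k≤∣B∣ = ℤP.drop‿+≤+ (subst (+ k ≤_) (sym (ℤP.0≤i⇒+∣i∣≡i (ℤP.≤-trans (+≤+ z≤n) k≤B))) k≤B)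

∈-concatMap⁺ : ∀ {A B : Set} (f : A → List B) {a as b} → a ∈ as → b ∈ f a → b ∈ concatMap f as
∈-concatMap⁺ f a∈ b∈ = ∈-concat⁺′ b∈ (∈-map⁺ f a∈)

infixl 5 _⊛_
_⊛_ : ∀ {A B : Set} → List (A → B) → List A → List B
_⊛_ = cartesianProductWith _$_

∈-⊛⁺ : ∀ {A B : Set} {fs : List (A → B)} {as f a} → f ∈ fs → a ∈ as → f a ∈ fs ⊛ as
∈-⊛⁺ = ∈-cartesianProductWith⁺ _$_

weight-trade : ∀ {a a' : ℕ} {s s' : ℤ} → a' ℕ.≤ 2 ℕ.+ a → s' < s → + a' + (s' + s') ≤ + a + (s + s)
weight-trade {a} {a'} {s} {s'} a'≤2+a s'<s = begin
  + a' + (s' + s')                     ≤⟨ ℤP.+-monoˡ-≤ (s' + s') (+≤+ a'≤2+a) ⟩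
  + (2 ℕ.+ a) + (s' + s')              ≡⟨ regroup a s' ⟩
  + a + (ℤ.suc s' + ℤ.suc s')          ≤⟨ ℤP.+-monoʳ-≤ (+ a) (ℤP.+-mono-≤ 1+s'≤s 1+s'≤s) ⟩
  + a + (s + s)                        ∎
  where
    open ℤP.≤-Reasoning
    1+s'≤s = ℤP.i<j⇒suc[i]≤j s'<s
    regroup : ∀ a s' → + (2 ℕ.+ a) + (s' + s') ≡ + a + (ℤ.suc s' + ℤ.suc s')
    regroup a s' = trans (cong (_+ (s' + s')) (ℤP.pos-+ 2 a)) (shuffle (+ a) s')
      where shuffle : ∀ a s' → + 2 + a + (s' + s') ≡ a + ((1ℤ + s') + (1ℤ + s'))
            shuffle = solve-∀

module Arrows {n : ℕ} (A : Fin n → Fin n → ℤ) (x : Fin n) (side : Fin n → Bool) where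

  open Stretch A x side
  open PathValues A x side
  open Potential A x side

  WellMarked : Notation → Set
  WellMarked N = p N ℕ.≤ q N × q N ℕ.≤ m N

  wellMarked-step : ∀ {N N'} → WellMarked N → Arrow N N' → WellMarked N'
  wellMarked-step wm           (op1-orig _ _ _ , _)           = wm
  wellMarked-step wm           (op1-path _ _ _ _ , _)         = wm
  wellMarked-step wm           (op2 _ _ _ _ , _)              = wm
  wellMarked-step (p≤q , q≤m)  (op3L _ , _)                   = ℕP.m≤n⇒m≤1+n p≤q , s≤s q≤m
  wellMarked-step (p≤q , q≤m)  (op3R _ , _)                   = ℕP.m≤n⇒m≤1+n p≤q , s≤s q≤m
  wellMarked-step wm           (op4L-keep _ _ _ , _)          = wm
  wellMarked-step (_ , q≤m)    (op4L-unmark p<q _ _ , _)      = p<q , q≤m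
  wellMarked-step wm           (op4R-keep _ _ _ , _)          = wm
  wellMarked-step (_ , q≤m)    (op4R-unmark p<q _ _ , _)      = ℕP.<⇒≤pred p<q , ℕP.≤⇒pred≤ q≤m

  -- Operation (1) at an original vertex can raise the potential by 2 but lowers the sum of the
  -- off-path values by at least 1.
  weight : Notation → ℤ
  weight N = + (m N ℕ.+ potential N) + (vsum (off N) + vsum (off N))

  weight-setPath : ∀ N {i r} p' q' → potential (setPath N i r p' q') ℕ.≤ potential N →
    weight (setPath N i r p' q') ≤ weight N
  weight-setPath N _ _ Φ'≤Φ = ℤP.+-monoˡ-≤ (vsum (off N) + vsum (off N)) (+≤+ (ℕP.+-monoʳ-≤ (m N) Φ'≤Φ))

  weight-insertPath : ∀ N {i s} p' q' → suc (potential (insertPath N i s p' q')) ℕ.≤ potential N →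
    weight (insertPath N i s p' q') ≤ weight N
  weight-insertPath N {i} {s} p' q' 1+Φ'≤Φ = ℤP.+-monoˡ-≤ (vsum (off N) + vsum (off N)) (+≤+ (begin
    suc (m N) ℕ.+ potential (insertPath N i s p' q') ≡⟨ sym (ℕP.+-suc (m N) _) ⟩
    m N ℕ.+ suc (potential (insertPath N i s p' q')) ≤⟨ ℕP.+-monoʳ-≤ (m N) 1+Φ'≤Φ ⟩
    m N ℕ.+ potential N                              ∎))
    where open ℕP.≤-Reasoning

  weight-step : ∀ {N N'} → WellMarked N → Arrow N N' → weight N' ≤ weight N
  weight-step {N} _ (op1-orig k _ r<o , _) = weight-trade
    (ℕP.≤-trans (ℕP.+-monoʳ-≤ (m N) (potential-update-outer N k _)) (ℕP.≤-reflexive (ℕ+.x∙yz≈y∙xz (m N) 2 _)))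
    (vsum-[]≔-< (off N) r<o)
  weight-step {N} (p≤q , q≤m) (op1-path _ i≤m outside _ , _) =
    weight-setPath N (p N) (q N) (ℕP.≤-reflexive (potential-reflect-outside N p≤q q≤m i≤m outside))
  weight-step {N} _ (op2 _ p<i i<q _ , _) =
    weight-setPath N (p N) (q N) (ℕP.≤-reflexive (potential-reflect-inside N p<i i<q))
  weight-step {N} (p≤q , q≤m) (op3L SL<b , _) =
    weight-insertPath N (p N) (suc (q N)) (potential-insert-left N p≤q q≤m SL<b)
  weight-step {N} (p≤q , q≤m) (op3R SR<b , _) =
    weight-insertPath N (p N) (suc (q N)) (potential-insert-right N p≤q q≤m SR<b)
  weight-step {N} (_ , q≤m) (op4L-keep p<q r<b _ , _) =
    weight-setPath N (p N) (q N) (potential-lower-left N p<q q≤m r<b)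
  weight-step {N} (_ , q≤m) (op4L-unmark p<q r<b b≤r , _) =
    weight-setPath N (suc (p N)) (q N) (potential-unmark-left N p<q q≤m r<b b≤r)
  weight-step {N} (_ , q≤m) (op4R-keep p<q r<b _ , _) =
    weight-setPath N (p N) (q N) (potential-lower-right N p<q q≤m r<b)
  weight-step {N} (_ , q≤m) (op4R-unmark p<q r<b b≤r , _) =
    weight-setPath N (p N) (q N ∸ 1) (potential-unmark-right N p<q q≤m r<b b≤r)

  total : Notation → ℤ
  total N = vsum (off N) + vsum (path N)

  _⊏_ : Notation → Notation → Set
  N ⊏ N' = ×-Lex _≡_ ℕ._<_ _>_ (m N , total N) (m N' , total N')

  ⊏-trans : ∀ {N₁ N₂ N₃} → N₁ ⊏ N₂ → N₂ ⊏ N₃ → N₁ ⊏ N₃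
  ⊏-trans = ×-transitive {_<₁_ = ℕ._<_} {_<₂_ = _>_} isEquivalence ℕP.<-resp₂-≡ ℕP.<-trans (flip ℤP.<-trans)

  ⊏-irrefl : ∀ {N} → ¬ N ⊏ N
  ⊏-irrefl = ×-irreflexive {_<₁_ = ℕ._<_} {_<₂_ = _>_} ℕP.<-irrefl (λ eq → ℤP.<-irrefl (sym eq)) (refl , refl)

  ⊏-setPath : ∀ N {i r} p' q' → i ℕ.≤ m N → r < b N i → N ⊏ setPath N i r p' q'
  ⊏-setPath N _ _ i≤m r<b = inj₂ (refl , ℤP.+-monoʳ-< (vsum (off N)) (vsum-vset-< (path N) (s≤s i≤m) r<b))

  ⊏-step : ∀ {N N'} → WellMarked N → Arrow N N' → N ⊏ N'
  ⊏-step {N} _         (op1-orig _ _ r<o , _)         = inj₂ (refl , ℤP.+-monoˡ-< (vsum (path N)) (vsum-[]≔-< (off N) r<o))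
  ⊏-step {N} _         (op1-path _ i≤m _ r<b , _)      = ⊏-setPath N (p N) (q N) i≤m r<b
  ⊏-step {N} (_ , q≤m) (op2 _ _ i<q r<b , _)           = ⊏-setPath N (p N) (q N) (ℕP.≤-trans (ℕP.<⇒≤ i<q) q≤m) r<b
  ⊏-step {N} _         (op3L _ , _)                    = inj₁ (ℕP.n<1+n (m N))
  ⊏-step {N} _         (op3R _ , _)                    = inj₁ (ℕP.n<1+n (m N))
  ⊏-step {N} (_ , q≤m) (op4L-keep p<q r<b _ , _)       = ⊏-setPath N (p N) (q N) (ℕP.≤-trans (ℕP.<⇒≤ p<q) q≤m) r<b
  ⊏-step {N} (_ , q≤m) (op4L-unmark p<q r<b _ , _)     =
    ⊏-setPath N (suc (p N)) (q N) (ℕP.≤-trans (ℕP.<⇒≤ p<q) q≤m) r<b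
  ⊏-step {N} (_ , q≤m) (op4R-keep _ r<b _ , _)         = ⊏-setPath N (p N) (q N) q≤m r<b
  ⊏-step {N} (_ , q≤m) (op4R-unmark _ r<b _ , _)       = ⊏-setPath N (p N) (q N ∸ 1) q≤m r<b

  Bounded : ℤ → Notation → Set
  Bounded B N = VAll.All (_≤ B) (off N) × VAll.All (_≤ B) (path N)

  module _ {B : ℤ} (0≤B : 0ℤ ≤ B) where

    private
      below-path : ∀ {N i r} → Bounded B N → r < b N i → r ≤ B
      below-path {N} {i} (_ , pathB) r<b = ℤP.≤-trans (ℤP.<⇒≤ r<b) (All-vget (path N) i pathB 0≤B)

      lowerPath : ∀ {N i r} p' q' → Bounded B N → r < b N i → Bounded B (setPath N i r p' q')
      lowerPath {N} {i} _ _ bd@(offB , pathB) r<b = offB , All-vset (path N) i pathB (below-path {N} bd r<b)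

      insertPath-bounded : ∀ {N i j s} p' q' → Bounded B N → s < b N j → Bounded B (insertPath N i s p' q')
      insertPath-bounded {N} {i} _ _ bd@(offB , pathB) s<b =
        offB , All-vins (path N) i pathB (below-path {N} bd s<b)

    bounded-step : ∀ {N N'} → Bounded B N → Arrow N N' → Bounded B N'
    bounded-step {N} (offB , pathB) (op1-orig k _ r<o , _) =
      All-[]≔ (off N) k offB (ℤP.≤-trans (ℤP.<⇒≤ r<o) (VAllP.lookup⁺ offB k)) , pathB
    bounded-step {N} bd (op1-path _ _ _ r<b , _)         = lowerPath {N} (p N) (q N) bd r<b
    bounded-step {N} bd (op2 _ _ _ r<b , _)              = lowerPath {N} (p N) (q N) bd r<b
    bounded-step {N} bd (op3L SL<b , _)                  = insertPath-bounded {N} (p N) (suc (q N)) bd SL<b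
    bounded-step {N} bd (op3R SR<b , _)                  = insertPath-bounded {N} (p N) (suc (q N)) bd SR<b
    bounded-step {N} bd (op4L-keep _ r<b _ , _)          = lowerPath {N} (p N) (q N) bd r<b
    bounded-step {N} bd (op4L-unmark _ r<b _ , _)        = lowerPath {N} (suc (p N)) (q N) bd r<b
    bounded-step {N} bd (op4R-keep _ r<b _ , _)          = lowerPath {N} (p N) (q N) bd r<b
    bounded-step {N} bd (op4R-unmark _ r<b _ , _)        = lowerPath {N} (p N) (q N ∸ 1) bd r<b

module Reachable {n : ℕ} (A : Fin n → Fin n → ℤ) (x : Fin n) (side : Fin n → Bool)
                 (α : Vec ℤ n) (α≥0 : NonNeg α) where

  open Stretch A x side
  open Potential A x side
  open Arrows A x side

  bound : ℤ
  bound = vsum α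

  0≤bound : 0ℤ ≤ bound
  0≤bound = vsum-nonneg α≥0

  initialWeight : ℤ
  initialWeight = weight (start α)

  record Invariant (N : Notation) : Set where
    field
      wellMarked : WellMarked N
      offNonNeg  : NonNeg (off N)
      pathNonNeg : NonNeg (path N)
      bounded    : Bounded bound N
      weight≤    : weight N ≤ initialWeight

  invariant : ∀ {N} → InP α N → Invariant N
  invariant base = record
    { wellMarked = z≤n , z≤n
    ; offNonNeg  = All-[]≔ α x α≥0 ℤP.≤-refl
    ; pathNonNeg = VAllP.lookup⁺ α≥0 x ∷ []
    ; bounded    = All-[]≔ α x (All-≤-vsum α≥0) 0≤bound , VAllP.lookup⁺ (All-≤-vsum α≥0) x ∷ []
    ; weight≤    = ℤP.≤-refl
    }
  invariant (step h arrow@(_ , offNonNeg' , pathNonNeg')) = record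
    { wellMarked = wellMarked-step wellMarked arrow
    ; offNonNeg  = offNonNeg'
    ; pathNonNeg = pathNonNeg'
    ; bounded    = bounded-step 0≤bound bounded arrow
    ; weight≤    = ℤP.≤-trans (weight-step wellMarked arrow) weight≤
    }
    where open Invariant (invariant h)

  maxLength : ℕ
  maxLength = ℤ.∣ initialWeight ∣

  length≤maxLength : ∀ {N} → Invariant N → m N ℕ.≤ maxLength
  length≤maxLength {N} inv = ℤP.drop‿+≤+ (begin
    + m N                    ≤⟨ +≤+ (ℕP.m≤m+n (m N) (potential N)) ⟩
    + (m N ℕ.+ potential N)  ≤⟨ i≤i+j _ 0≤2S ⟩
    weight N                 ≤⟨ weight≤ ⟩
    initialWeight            ≡⟨ sym (ℤP.0≤i⇒+∣i∣≡i (ℤP.≤-trans (ℤP.+-mono-≤ (+≤+ z≤n) 0≤2S) weight≤)) ⟩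
    + maxLength              ∎)
    where
      open Invariant inv
      open ℤP.≤-Reasoning
      0≤2S : 0ℤ ≤ vsum (off N) + vsum (off N)
      0≤2S = ℤP.+-mono-≤ (vsum-nonneg offNonNeg) (vsum-nonneg offNonNeg)

  values : List ℤ
  values = integersUpTo bound

  notationsOfLength : ℕ → List Notation
  notationsOfLength k =
    map (notation k) (vectorsOver values n) ⊛ vectorsOver values (suc k) ⊛ upTo (suc k) ⊛ upTo (suc k)

  candidates : List Notation
  candidates = concatMap notationsOfLength (upTo (suc maxLength))

  ∈-candidates : ∀ {N} → Invariant N → N ∈ candidates
  ∈-candidates {notation k o pa p q} inv =
    ∈-concatMap⁺ notationsOfLength (∈-upTo⁺ (s≤s (length≤maxLength inv)))
      (∈-⊛⁺ (∈-⊛⁺ (∈-⊛⁺ (∈-map⁺ (notation k) (valuesIn offNonNeg (proj₁ bounded)))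
                         (valuesIn pathNonNeg (proj₂ bounded)))
                  (∈-upTo⁺ (s≤s (ℕP.≤-trans p≤q q≤m))))
            (∈-upTo⁺ (s≤s q≤m)))
    where
      open Invariant inv
      p≤q = proj₁ wellMarked
      q≤m = proj₂ wellMarked
      valuesIn : ∀ {l} {v : Vec ℤ l} → NonNeg v → VAll.All (_≤ bound) v → v ∈ vectorsOver values l
      valuesIn 0≤v v≤B = ∈-vectorsOver (VAll.map (λ (0≤a , a≤B) → ∈-integersUpTo 0≤a a≤B) (VAll.zip (0≤v , v≤B)))

  ⊏-transClosure : ∀ {N N'} → InP α N → TransClosure Arrow N N' → N ⊏ N'
  ⊏-transClosure h [ arrow ]      = ⊏-step (Invariant.wellMarked (invariant h)) arrow
  ⊏-transClosure {N} {N'} h (_∷_ {y = N₁} arrow rest) =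
    ⊏-trans {N} {N₁} {N'} (⊏-step (Invariant.wellMarked (invariant h)) arrow) (⊏-transClosure (step h arrow) rest)

lemma3p3 : {n : ℕ} (A : Fin n → Fin n → ℤ) → IsCartan A →
    (x : Fin n) (side : Fin n → Bool) (α : Vec ℤ n) →
    Roots.IsPositiveRoot A α →
    (Σ (List (Stretch.Notation A x side))
       (λ Ls → ∀ N → Stretch.InP A x side α N → N ∈ Ls))
    × (∀ N → Stretch.InP A x side α N →
         ¬ TransClosure (Stretch.Arrow A x side) N N)
lemma3p3 A _ x side α (_ , α≥0) =
  (candidates , λ _ reachable → ∈-candidates (invariant reachable)) ,
  λ N reachable cycle → ⊏-irrefl {N} (⊏-transClosure reachable cycle)
  where
    open Reachable A x side α α≥0
    open Arrows A x side using (⊏-irrefl)
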